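{- Let $n$ be a positive integer and $x\in\mathbb{C}$ such that $x+n+2\neq0$ and $\binom{x+n}{k}\neq0$ for $1\le k\le n$. Then \[ \sum_{k=1}^n\frac{(-1)^k}{\binom{x+n}{k}}H_{k}=\frac{n+1}{x+n+2}\,\frac{(-1)^n}{\binom{x+n}{n}}\left(H_{n+1}-\frac{1}{x+n+2}\right)-\frac{x+n+1}{(x+n+2)^2}. \]
   Context: $H_0=0$ and $H_m=\sum_{j=1}^m \frac1j$ for $m\ge1$. For $z\in\mathbb{C}$ and $k\in\mathbb{N}_0$, $\binom{z}{k}=\frac{z(z-1)\cdots(z-k+1)}{k!}$. -}

module Defs where

open import Level using (Level; _⊔_) renaming (suc to lsuc)
open import Data.Nat using (ℕ; zero; suc)
open import Data.Nat.Combinatorics using ()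
open import Data.Nat.Base using (_!)
open import Algebra.Bundles using (CommutativeRing)
open import Relation.Nullary using (¬_)

-- A field: a commutative ring with 0 ≠ 1 and a (total) inverse operation
-- that is a genuine inverse on every nonzero element (value at 0 unconstrained,
-- as in Lean/Mathlib).
record Field (c ℓ : Level) : Set (lsuc (c ⊔ ℓ)) where
  field
    commutativeRing : CommutativeRing c ℓ
  open CommutativeRing commutativeRing public
  field
    _⁻¹      : Carrier → Carrier
    ⁻¹-cong  : ∀ {x y} → x ≈ y → x ⁻¹ ≈ y ⁻¹
    inverseʳ : ∀ x → ¬ (x ≈ 0#) → x * (x ⁻¹) ≈ 1#
    0≉1      : ¬ (0# ≈ 1#)

module Ops {c ℓ : Level} (F : Field c ℓ) where
  open Field F

  ι : ℕ → Carrier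
  ι zero    = 0#
  ι (suc n) = 1# + ι n

  _÷_ : Carrier → Carrier → Carrier
  x ÷ y = x * (y ⁻¹)

  sgn : ℕ → Carrier
  sgn zero    = 1#
  sgn (suc k) = - sgn k

  H : ℕ → Carrier
  H zero    = 0#
  H (suc m) = H m + (ι (suc m)) ⁻¹

  fall : Carrier → ℕ → Carrier
  fall z zero    = 1#
  fall z (suc k) = fall z k * (z - ι k)

  binom : Carrier → ℕ → Carrier
  binom z k = fall z k ÷ ι (k !)

  sum1 : ℕ → (ℕ → Carrier) → Carrier
  sum1 zero    f = 0#
  sum1 (suc n) f = sum1 n f + f (suc n)

CharZero : {c ℓ : Level} → Field c ℓ → Set ℓ
CharZero F = ∀ n → ¬ (ι (suc n) ≈ 0#)
  where open Field F
        open Ops F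

-- With y = x + n and T k = (-1)^k / binom(y,k), the absorption identity
-- binom(y,k+1) (k+1) = binom(y,k) (y-k) gives T(k+1) (y-k) = -(k+1) T k.  Using it, the
-- term R n = (n+1)/(y+2) · T n · (H(n+1) - 1/(y+2)) satisfies R n + T(n+1) H(n+1) = R(n+1),
-- so the sum telescopes to R n - R 0, and R 0 = (y+1)/(y+2)^2.
module Submission where

open import Defs
open import Data.Nat using (ℕ; _≤_)
open import Relation.Nullary using (¬_)
open import Level using (Level)
open import Algebra.Bundles using (CommutativeRing)
import Data.Nat.Base as ℕ
import Data.Nat.Properties as ℕ

-- Over ℤ the coefficients of normal forms are canonical, so the solver also proves identities
-- that need cancellation (x - x ≈ 0), which it cannot do with the ring's own elements as
-- coefficients.
module IntegerCoefficientSolver {c ℓ : Level} (R : CommutativeRing c ℓ) where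
  open import Algebra.Solver.Ring.AlmostCommutativeRing
    using (fromCommutativeRing; _-Raw-AlmostCommutative⟶_)
  open import Data.Integer.Base as ℤ using (ℤ; +_; -[1+_]; _⊖_; _◃_; sign; ∣_∣)
  import Data.Integer.Properties as ℤ
  open import Data.Sign.Base as Sign using (Sign)
  open import Data.Maybe.Base using (Maybe; just; nothing)
  open import Relation.Nullary.Decidable using (yes; no)
  import Relation.Binary.PropositionalEquality as ≡
  open CommutativeRing R
  open import Algebra.Properties.Ring ring
    using (-‿involutive; -‿+-comm; -0#≈0#; -1*x≈-x)
  open import Algebra.Properties.CommutativeSemigroup +-commutativeSemigroup
    using () renaming (interchange to +-interchange)
  open import Algebra.Properties.CommutativeSemigroup *-commutativeSemigroup
    using () renaming (interchange to *-interchange)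
  open import Algebra.Properties.Semiring.Mult.TCOptimised semiring
    using (_×_; 1+×; ×-homo-+; ×1-homo-*)
  open import Relation.Binary.Reasoning.Setoid setoid

  fromSign : Sign → Carrier
  fromSign Sign.+ = 1#
  fromSign Sign.- = - 1#

  fromℤ : ℤ → Carrier
  fromℤ (+ n)      = n × 1#
  fromℤ -[1+ n ]   = - (ℕ.suc n × 1#)

  fromSign-* : ∀ s t → fromSign (s Sign.* t) ≈ fromSign s * fromSign t
  fromSign-* Sign.+ t       = sym (*-identityˡ _)
  fromSign-* Sign.- Sign.+  = sym (*-identityʳ _)
  fromSign-* Sign.- Sign.-  = sym (trans (-1*x≈-x _) (-‿involutive _))

  fromℤ-◃ : ∀ s n → fromℤ (s ◃ n) ≈ fromSign s * (n × 1#)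
  fromℤ-◃ s      ℕ.zero    = sym (zeroʳ _)
  fromℤ-◃ Sign.+ (ℕ.suc n) = sym (*-identityˡ _)
  fromℤ-◃ Sign.- (ℕ.suc n) = sym (-1*x≈-x _)

  fromℤ-signAbs : ∀ i → fromℤ i ≈ fromSign (sign i) * (∣ i ∣ × 1#)
  fromℤ-signAbs i = trans (reflexive (≡.cong fromℤ (≡.sym (ℤ.◃-inverse i)))) (fromℤ-◃ (sign i) ∣ i ∣)

  -‿cancel-+ˡ : ∀ z x y → (z + x) - (z + y) ≈ x - y
  -‿cancel-+ˡ z x y = begin
    (z + x) + - (z + y)   ≈⟨ +-congˡ (sym (-‿+-comm z y)) ⟩
    (z + x) + (- z + - y) ≈⟨ +-interchange z x (- z) (- y) ⟩
    (z - z) + (x - y)     ≈⟨ +-congʳ (-‿inverseʳ z) ⟩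
    0# + (x - y)          ≈⟨ +-identityˡ _ ⟩
    x - y                 ∎

  fromℤ-⊖ : ∀ m n → fromℤ (m ⊖ n) ≈ m × 1# - n × 1#
  fromℤ-⊖ m         ℕ.zero    = sym (trans (+-congˡ -0#≈0#) (+-identityʳ _))
  fromℤ-⊖ ℕ.zero    (ℕ.suc n) = sym (+-identityˡ _)
  fromℤ-⊖ (ℕ.suc m) (ℕ.suc n) = begin
    fromℤ (ℕ.suc m ⊖ ℕ.suc n)               ≡⟨ ≡.cong fromℤ (ℤ.[1+m]⊖[1+n]≡m⊖n m n) ⟩
    fromℤ (m ⊖ n)                           ≈⟨ fromℤ-⊖ m n ⟩
    m × 1# - n × 1#                         ≈⟨ sym (-‿cancel-+ˡ 1# _ _) ⟩
    (1# + m × 1#) - (1# + n × 1#)           ≈⟨ sym (+-cong (1+× m 1#) (-‿cong (1+× n 1#))) ⟩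
    ℕ.suc m × 1# - ℕ.suc n × 1#             ∎

  fromℤ-+ : ∀ i j → fromℤ (i ℤ.+ j) ≈ fromℤ i + fromℤ j
  fromℤ-+ -[1+ m ] -[1+ n ] = begin
    - (ℕ.suc (ℕ.suc (m ℕ.+ n)) × 1#)          ≡⟨ ≡.cong (λ k → - (ℕ.suc k × 1#)) (≡.sym (ℕ.+-suc m n)) ⟩
    - ((ℕ.suc m ℕ.+ ℕ.suc n) × 1#)            ≈⟨ -‿cong (×-homo-+ 1# (ℕ.suc m) (ℕ.suc n)) ⟩
    - (ℕ.suc m × 1# + ℕ.suc n × 1#)           ≈⟨ sym (-‿+-comm _ _) ⟩
    - (ℕ.suc m × 1#) + - (ℕ.suc n × 1#)       ∎
  fromℤ-+ -[1+ m ] (+ n)    = trans (fromℤ-⊖ n (ℕ.suc m)) (+-comm _ _)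
  fromℤ-+ (+ m)    -[1+ n ] = fromℤ-⊖ m (ℕ.suc n)
  fromℤ-+ (+ m)    (+ n)    = ×-homo-+ 1# m n

  fromℤ-* : ∀ i j → fromℤ (i ℤ.* j) ≈ fromℤ i * fromℤ j
  fromℤ-* i j = begin
    fromℤ ((sign i Sign.* sign j) ◃ (∣ i ∣ ℕ.* ∣ j ∣))
      ≈⟨ fromℤ-◃ (sign i Sign.* sign j) (∣ i ∣ ℕ.* ∣ j ∣) ⟩
    fromSign (sign i Sign.* sign j) * ((∣ i ∣ ℕ.* ∣ j ∣) × 1#)
      ≈⟨ *-cong (fromSign-* (sign i) (sign j)) (×1-homo-* ∣ i ∣ ∣ j ∣) ⟩
    (fromSign (sign i) * fromSign (sign j)) * ((∣ i ∣ × 1#) * (∣ j ∣ × 1#))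
      ≈⟨ *-interchange _ _ _ _ ⟩
    (fromSign (sign i) * (∣ i ∣ × 1#)) * (fromSign (sign j) * (∣ j ∣ × 1#))
      ≈⟨ sym (*-cong (fromℤ-signAbs i) (fromℤ-signAbs j)) ⟩
    fromℤ i * fromℤ j
      ∎

  fromℤ-neg : ∀ i → fromℤ (ℤ.- i) ≈ - fromℤ i
  fromℤ-neg -[1+ n ]       = sym (-‿involutive _)
  fromℤ-neg (+ ℕ.zero)     = sym -0#≈0#
  fromℤ-neg (+ (ℕ.suc n))  = refl

  fromℤ-homomorphism : ℤ.+-*-rawRing -Raw-AlmostCommutative⟶ fromCommutativeRing R
  fromℤ-homomorphism = record
    { ⟦_⟧    = fromℤ
    ; +-homo = fromℤ-+
    ; *-homo = fromℤ-*
    ; -‿homo = fromℤ-neg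
    ; 0-homo = refl
    ; 1-homo = refl
    }

  fromℤ-≟ : ∀ i j → Maybe (fromℤ i ≈ fromℤ j)
  fromℤ-≟ i j with i ℤ.≟ j
  ... | yes ≡.refl = just refl
  ... | no _       = nothing

  open import Algebra.Solver.Ring ℤ.+-*-rawRing (fromCommutativeRing R) fromℤ-homomorphism fromℤ-≟
    public using (solve; _:=_; con; _:+_; _:*_; _:-_; :-_)

module FieldProperties {c ℓ : Level} (F : Field c ℓ) where
  open Field F
  open Ops F
  open import Algebra.Properties.Ring ring using (x≈y⇒x∙y⁻¹≈ε)
  open import Algebra.Properties.Semiring.Mult semiring using (_×_; ×1-homo-*)
  open import Relation.Binary.Reasoning.Setoid setoid
  open IntegerCoefficientSolver commutativeRing
  open import Data.Integer.Base using (+_)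

  -- Field identities below are proved as ring identities  lhs ≈ rhs + Σ eᵢ * wᵢ  whose
  -- defects eᵢ (such as u * u ⁻¹ - 1#) are then shown to vanish.
  +-vanishʳ : ∀ {e} b w → e ≈ 0# → b + e * w ≈ b
  +-vanishʳ b w e≈0 = trans (+-congˡ (trans (*-congʳ e≈0) (zeroˡ w))) (+-identityʳ b)

  ⁻¹-unique : ∀ {x y} → x * y ≈ 1# → x ⁻¹ ≈ y
  ⁻¹-unique {x} {y} xy≈1 = begin
    x ⁻¹              ≈⟨ sym (*-identityʳ _) ⟩
    x ⁻¹ * 1#         ≈⟨ *-congˡ (sym xy≈1) ⟩
    x ⁻¹ * (x * y)    ≈⟨ sym (*-assoc _ _ _) ⟩
    (x ⁻¹ * x) * y    ≈⟨ *-congʳ (trans (*-comm _ _) (inverseʳ x x≉0)) ⟩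
    1# * y            ≈⟨ *-identityˡ y ⟩
    y                 ∎
    where
    x≉0 : ¬ x ≈ 0#
    x≉0 x≈0 = 0≉1 (trans (sym (zeroˡ y)) (trans (*-congʳ (sym x≈0)) xy≈1))

  ⁻¹-≈1 : ∀ {x} → x ≈ 1# → x ⁻¹ ≈ 1#
  ⁻¹-≈1 x≈1 = ⁻¹-unique (trans (*-identityʳ _) x≈1)

  ⁻¹-* : ∀ {x y} → ¬ x ≈ 0# → ¬ y ≈ 0# → (x * y) ⁻¹ ≈ x ⁻¹ * y ⁻¹
  ⁻¹-* {x} {y} x≉0 y≉0 = ⁻¹-unique (begin
    (x * y) * (x ⁻¹ * y ⁻¹)   ≈⟨ interchange x y (x ⁻¹) (y ⁻¹) ⟩
    (x * x ⁻¹) * (y * y ⁻¹)   ≈⟨ *-cong (inverseʳ x x≉0) (inverseʳ y y≉0) ⟩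
    1# * 1#                   ≈⟨ *-identityʳ 1# ⟩
    1#                        ∎)
    where open import Algebra.Properties.CommutativeSemigroup *-commutativeSemigroup using (interchange)

  ι≈×1 : ∀ n → ι n ≈ n × 1#
  ι≈×1 ℕ.zero    = refl
  ι≈×1 (ℕ.suc n) = +-congˡ (ι≈×1 n)

  ι-* : ∀ m n → ι (m ℕ.* n) ≈ ι m * ι n
  ι-* m n = trans (ι≈×1 (m ℕ.* n)) (trans (×1-homo-* m n) (sym (*-cong (ι≈×1 m) (ι≈×1 n))))

  *-cross-⁻¹ : ∀ {a b c e} → ¬ a ≈ 0# → ¬ c ≈ 0# → a * b ≈ c * e → e * a ⁻¹ ≈ b * c ⁻¹
  *-cross-⁻¹ {a} {b} {c} {e} a≉0 c≉0 ab≈ce = begin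
    e * a ⁻¹
      ≈⟨ expand a (a ⁻¹) b c (c ⁻¹) e ⟩
    ((b * c ⁻¹ + (a * a ⁻¹ - 1#) * (b * c ⁻¹)) + (a * b - c * e) * - (c ⁻¹ * a ⁻¹))
      + (c * c ⁻¹ - 1#) * - (e * a ⁻¹)
      ≈⟨ +-vanishʳ _ _ (x≈y⇒x∙y⁻¹≈ε (inverseʳ c c≉0)) ⟩
    (b * c ⁻¹ + (a * a ⁻¹ - 1#) * (b * c ⁻¹)) + (a * b - c * e) * - (c ⁻¹ * a ⁻¹)
      ≈⟨ +-vanishʳ _ _ (x≈y⇒x∙y⁻¹≈ε ab≈ce) ⟩
    b * c ⁻¹ + (a * a ⁻¹ - 1#) * (b * c ⁻¹)
      ≈⟨ +-vanishʳ _ _ (x≈y⇒x∙y⁻¹≈ε (inverseʳ a a≉0)) ⟩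
    b * c ⁻¹
      ∎
    where
    expand : ∀ a a⁻ b c c⁻ e →
      e * a⁻ ≈ ((b * c⁻ + (a * a⁻ - 1#) * (b * c⁻)) + (a * b - c * e) * - (c⁻ * a⁻))
                 + (c * c⁻ - 1#) * - (e * a⁻)
    expand = solve 6 (λ a a⁻ b c c⁻ e →
      e :* a⁻ := ((b :* c⁻ :+ (a :* a⁻ :- con (+ 1)) :* (b :* c⁻)) :+ (a :* b :- c :* e) :* :- (c⁻ :* a⁻))
                   :+ (c :* c⁻ :- con (+ 1)) :* :- (e :* a⁻)) refl

module HarmonicBinomialSum {c ℓ : Level} (F : Field c ℓ) (charZero : CharZero F) where
  open Field F
  open Ops F
  open FieldProperties F
  open IntegerCoefficientSolver commutativeRing
  open import Data.Integer.Base using (+_)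
  open import Algebra.Properties.Ring ring using (x≈y⇒x∙y⁻¹≈ε)
  open import Relation.Binary.Reasoning.Setoid setoid
  open import Data.Nat.Base using (suc; _!; s≤s; z≤n)

  ι-nonZero : ∀ n .{{_ : ℕ.NonZero n}} → ¬ ι n ≈ 0#
  ι-nonZero (suc n) = charZero n

  ι[n!]≉0 : ∀ n → ¬ ι (n !) ≈ 0#
  ι[n!]≉0 n = ι-nonZero (n !) {{n ℕ.!≢0}}

  binom-zero : ∀ z → binom z 0 ≈ 1#
  binom-zero z = trans (*-identityˡ _) (⁻¹-≈1 (+-identityʳ 1#))

  binom-suc : ∀ z k → binom z (suc k) * ι (suc k) ≈ binom z k * (z - ι k)
  binom-suc z k = begin
    (fall z k * (z - ι k)) * ι (suc k !) ⁻¹ * ι (suc k)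
      ≈⟨ *-congʳ (*-congˡ (trans (⁻¹-cong (ι-* (suc k) (k !))) (⁻¹-* (charZero k) (ι[n!]≉0 k)))) ⟩
    (fall z k * (z - ι k)) * (ι (suc k) ⁻¹ * ι (k !) ⁻¹) * ι (suc k)
      ≈⟨ expand (fall z k) (z - ι k) (ι (suc k)) (ι (suc k) ⁻¹) (ι (k !) ⁻¹) ⟩
    binom z k * (z - ι k) + (ι (suc k) * ι (suc k) ⁻¹ - 1#) * (binom z k * (z - ι k))
      ≈⟨ +-vanishʳ _ _ (x≈y⇒x∙y⁻¹≈ε (inverseʳ _ (charZero k))) ⟩
    binom z k * (z - ι k)
      ∎
    where
    expand : ∀ f t n n⁻ m⁻ →
      (f * t) * (n⁻ * m⁻) * n ≈ (f * m⁻) * t + (n * n⁻ - 1#) * ((f * m⁻) * t)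
    expand = solve 5 (λ f t n n⁻ m⁻ →
      (f :* t) :* (n⁻ :* m⁻) :* n := (f :* m⁻) :* t :+ (n :* n⁻ :- con (+ 1)) :* ((f :* m⁻) :* t)) refl

  recipBinom : Carrier → ℕ → Carrier
  recipBinom z k = sgn k ÷ binom z k

  recipBinom-suc : ∀ z k → ¬ binom z k ≈ 0# → ¬ binom z (suc k) ≈ 0# →
                   recipBinom z (suc k) * (z - ι k) ≈ - (ι (suc k) * recipBinom z k)
  recipBinom-suc z k b≉0 b'≉0 = begin
    (- sgn k * binom z (suc k) ⁻¹) * (z - ι k)
      ≈⟨ expand (sgn k) (binom z (suc k) ⁻¹) (z - ι k) (ι (suc k)) (binom z k ⁻¹) ⟩
    - (ι (suc k) * (sgn k * binom z k ⁻¹))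
      + ((z - ι k) * binom z (suc k) ⁻¹ - ι (suc k) * binom z k ⁻¹) * - sgn k
      ≈⟨ +-vanishʳ _ _ (x≈y⇒x∙y⁻¹≈ε (*-cross-⁻¹ b'≉0 b≉0 (binom-suc z k))) ⟩
    - (ι (suc k) * (sgn k * binom z k ⁻¹))
      ∎
    where
    expand : ∀ s b' t n b → (- s * b') * t ≈ - (n * (s * b)) + (t * b' - n * b) * - s
    expand = solve 5 (λ s b' t n b →
      (:- s :* b') :* t := :- (n :* (s :* b)) :+ (t :* b' :- n :* b) :* :- s) refl

  module _ (y : Carrier) (y+2≉0 : ¬ y + ι 2 ≈ 0#) where

    closedTerm : ℕ → Carrier
    closedTerm n = (ι (suc n) ÷ (y + ι 2)) * recipBinom y n * (H (suc n) - (1# ÷ (y + ι 2)))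

    offset : Carrier
    offset = (y + ι 1) ÷ ((y + ι 2) * (y + ι 2))

    private
      d : Carrier
      d = (y + ι 2) ⁻¹

    closedTerm-zero : closedTerm 0 ≈ offset
    closedTerm-zero = begin
      closedTerm 0
        ≈⟨ *-cong (*-congˡ (*-congˡ (⁻¹-≈1 (binom-zero y)))) (+-congʳ (+-congˡ (⁻¹-≈1 (+-identityʳ 1#)))) ⟩
      ((1# + 0#) * d) * (1# * 1#) * ((0# + 1#) - 1# * d)
        ≈⟨ expand y d ⟩
      (y + ι 1) * (d * d) + ((y + ι 2) * d - 1#) * - d
        ≈⟨ +-vanishʳ _ _ (x≈y⇒x∙y⁻¹≈ε (inverseʳ _ y+2≉0)) ⟩
      (y + ι 1) * (d * d)
        ≈⟨ *-congˡ (sym (⁻¹-* y+2≉0 y+2≉0)) ⟩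
      offset
        ∎
      where
      expand : ∀ y d → ((1# + 0#) * d) * (1# * 1#) * ((0# + 1#) - 1# * d)
                     ≈ (y + ι 1) * (d * d) + ((y + ι 2) * d - 1#) * - d
      expand = solve 2 (λ y d →
        ((con (+ 1) :+ con (+ 0)) :* d) :* (con (+ 1) :* con (+ 1)) :* ((con (+ 0) :+ con (+ 1)) :- con (+ 1) :* d)
        := (y :+ (con (+ 1) :+ con (+ 0))) :* (d :* d)
           :+ ((y :+ (con (+ 1) :+ (con (+ 1) :+ con (+ 0)))) :* d :- con (+ 1)) :* :- d) refl

    closedTerm-suc : ∀ n → ¬ binom y n ≈ 0# → ¬ binom y (suc n) ≈ 0# →
                     closedTerm n + recipBinom y (suc n) * H (suc n) ≈ closedTerm (suc n)
    closedTerm-suc n b≉0 b'≉0 = begin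
      closedTerm n + t' * h
        ≈⟨ expand y (ι n) d (ι (suc (suc n)) ⁻¹) t t' h ⟩
      ((closedTerm (suc n) + ((y + ι 2) * d - 1#) * - (t' * (h - 1# * d)))
        + (ι (suc (suc n)) * ι (suc (suc n)) ⁻¹ - 1#) * - (d * t'))
        + (t' * (y - ι n) + ι (suc n) * t) * (d * (h - 1# * d))
        ≈⟨ +-vanishʳ _ _ (trans (+-congʳ (recipBinom-suc y n b≉0 b'≉0)) (-‿inverseˡ _)) ⟩
      (closedTerm (suc n) + ((y + ι 2) * d - 1#) * - (t' * (h - 1# * d)))
        + (ι (suc (suc n)) * ι (suc (suc n)) ⁻¹ - 1#) * - (d * t')
        ≈⟨ +-vanishʳ _ _ (x≈y⇒x∙y⁻¹≈ε (inverseʳ _ (charZero (suc n)))) ⟩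
      closedTerm (suc n) + ((y + ι 2) * d - 1#) * - (t' * (h - 1# * d))
        ≈⟨ +-vanishʳ _ _ (x≈y⇒x∙y⁻¹≈ε (inverseʳ _ y+2≉0)) ⟩
      closedTerm (suc n)
        ∎
      where
      t t' h : Carrier
      t  = recipBinom y n
      t' = recipBinom y (suc n)
      h  = H (suc n)
      expand : ∀ y m d e t t' h →
        ((1# + m) * d) * t * (h - 1# * d) + t' * h
          ≈ (((((1# + (1# + m)) * d) * t' * ((h + e) - 1# * d)
                + ((y + ι 2) * d - 1#) * - (t' * (h - 1# * d)))
                + ((1# + (1# + m)) * e - 1#) * - (d * t'))
                + (t' * (y - m) + (1# + m) * t) * (d * (h - 1# * d)))
      expand = solve 7 (λ y m d e t t' h →
        ((con (+ 1) :+ m) :* d) :* t :* (h :- con (+ 1) :* d) :+ t' :* h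
        := ((((con (+ 1) :+ (con (+ 1) :+ m)) :* d) :* t' :* ((h :+ e) :- con (+ 1) :* d)
              :+ ((y :+ (con (+ 1) :+ (con (+ 1) :+ con (+ 0)))) :* d :- con (+ 1)) :* :- (t' :* (h :- con (+ 1) :* d)))
              :+ ((con (+ 1) :+ (con (+ 1) :+ m)) :* e :- con (+ 1)) :* :- (d :* t'))
              :+ (t' :* (y :- m) :+ (con (+ 1) :+ m) :* t) :* (d :* (h :- con (+ 1) :* d))) refl

    sum-recipBinom*H : ∀ n → (∀ k → 1 ≤ k → k ≤ n → ¬ binom y k ≈ 0#) →
                       sum1 n (λ k → recipBinom y k * H k) ≈ closedTerm n - offset
    sum-recipBinom*H ℕ.zero    _    = sym (x≈y⇒x∙y⁻¹≈ε closedTerm-zero)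
    sum-recipBinom*H (suc n) b≉0 = begin
      sum1 n (λ k → recipBinom y k * H k) + recipBinom y (suc n) * H (suc n)
        ≈⟨ +-congʳ (sum-recipBinom*H n (λ k 1≤k k≤n → b≉0 k 1≤k (ℕ.m≤n⇒m≤1+n k≤n))) ⟩
      (closedTerm n - offset) + recipBinom y (suc n) * H (suc n)
        ≈⟨ swap (closedTerm n) offset _ ⟩
      (closedTerm n + recipBinom y (suc n) * H (suc n)) - offset
        ≈⟨ +-congʳ (closedTerm-suc n (binom-≉0 n ℕ.≤-refl) (b≉0 (suc n) (s≤s z≤n) ℕ.≤-refl)) ⟩
      closedTerm (suc n) - offset
        ∎
      where
      binom-≉0 : ∀ k → k ≤ n → ¬ binom y k ≈ 0#
      binom-≉0 ℕ.zero    _   b≈0 = 0≉1 (trans (sym b≈0) (binom-zero y))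
      binom-≉0 (suc k) k≤n       = b≉0 (suc k) (s≤s z≤n) (ℕ.m≤n⇒m≤1+n k≤n)
      swap : ∀ a o b → (a - o) + b ≈ (a + b) - o
      swap = solve 3 (λ a o b → (a :- o) :+ b := (a :+ b) :- o) refl

corollary7 : ∀ {c ℓ} (F : Field c ℓ) → CharZero F →
    let open Field F
        open Ops F
    in (n : ℕ) → 1 ≤ n → (x : Carrier) →
       ¬ (x + ι n + ι 2 ≈ 0#) →
       (∀ k → 1 ≤ k → k ≤ n → ¬ (binom (x + ι n) k ≈ 0#)) →
       sum1 n (λ k → (sgn k ÷ binom (x + ι n) k) * H k)
         ≈ (ι (n Data.Nat.+ 1) ÷ (x + ι n + ι 2)) * (sgn n ÷ binom (x + ι n) n)
             * (H (n Data.Nat.+ 1) - (1# ÷ (x + ι n + ι 2)))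
           - ((x + ι n + ι 1) ÷ ((x + ι n + ι 2) * (x + ι n + ι 2)))
corollary7 F charZero n _ x y+2≉0 binom≉0 rewrite ℕ.+-comm n 1 =
  HarmonicBinomialSum.sum-recipBinom*H F charZero (x + ι n) y+2≉0 n binom≉0
  where open Field F using (_+_)
        open Ops F using (ι)
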